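{- For each even integer $t \ge 6$ define \begin{align*} Q_t(x) &= 2x^{2t+1} - 2x^{2t-1} + 2x^{2t-2} + x^{t+3} - x^{t+2} + x^{t-1} - x^{t-2} - 2x^3 + 2x^2 - 2 ,\\ R_t(x) &= 2x^{2t+1} - 2x^{2t-1} + 2x^{2t-2} - x^{t+3} + x^{t+2} - 4x^{t+1} + 4x^t - x^{t-1} + x^{t-2} - 2x^3 + 2x^2 - 2 . \end{align*} For each even $t \ge 6$ and each prime $p \ge 11$, $Q_t(x)$ is divisible neither by $\Phi_p(x)$ nor by $\Phi_{2p}(x)$. For each even $t \ge 6$ and each prime $p \ge 13$, $R_t(x)$ is divisible neither by $\Phi_p(x)$ nor by $\Phi_{2p}(x)$.
   Context: $\Phi_b(x)$ denotes the $b$-th cyclotomic polynomial, $\Phi_b(x) = \prod_\xi (x - \xi)$ with $\xi$ ranging over the primitive $b$-th roots of unity; divisibility is in $\mathbb{Q}[x]$. -}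

module Defs where

open import Data.Nat using (ℕ; zero; suc; _+_; _∸_)
open import Data.Integer using (ℤ; +_; -[1+_])
open import Data.Rational using (ℚ; 0ℚ; 1ℚ; _/_; -_) renaming (_+_ to _+ℚ_; _*_ to _*ℚ_)
open import Data.List using (List; []; _∷_; replicate; _++_; foldr)
open import Data.Product using (∃)
open import Relation.Binary.PropositionalEquality using (_≡_)

-- Polynomials in ℚ[x] as coefficient lists, constant term first.
-- Trailing zeros are allowed; equality is coefficientwise (see _≈ₚ_).
Poly : Set
Poly = List ℚ

coeff : Poly → ℕ → ℚ
coeff []       _       = 0ℚ
coeff (a ∷ as) zero    = a
coeff (a ∷ as) (suc n) = coeff as n

_≈ₚ_ : Poly → Poly → Set
f ≈ₚ g = ∀ n → coeff f n ≡ coeff g n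

_+ₚ_ : Poly → Poly → Poly
[]       +ₚ g        = g
(a ∷ f)  +ₚ []       = a ∷ f
(a ∷ f)  +ₚ (b ∷ g)  = (a +ℚ b) ∷ (f +ₚ g)

scaleₚ : ℚ → Poly → Poly
scaleₚ c []       = []
scaleₚ c (a ∷ f)  = (c *ℚ a) ∷ scaleₚ c f

_*ₚ_ : Poly → Poly → Poly
[]      *ₚ g = []
(a ∷ f) *ₚ g = scaleₚ a g +ₚ (0ℚ ∷ (f *ₚ g))

_∣ₚ_ : Poly → Poly → Set
d ∣ₚ f = ∃ λ g → (d *ₚ g) ≈ₚ f

mono : ℤ → ℕ → Poly
mono c k = replicate k 0ℚ ++ ((c / 1) ∷ [])

sumₚ : List Poly → Poly
sumₚ = foldr _+ₚ_ []

two : ℤ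
two = + 2

mtwo : ℤ
mtwo = -[1+ 1 ]

one : ℤ
one = + 1

mone : ℤ
mone = -[1+ 0 ]

four : ℤ
four = + 4

mfour : ℤ
mfour = -[1+ 3 ]

-- Q_t(x) = 2x^{2t+1} - 2x^{2t-1} + 2x^{2t-2} + x^{t+3} - x^{t+2} + x^{t-1} - x^{t-2} - 2x^3 + 2x^2 - 2
-- (used only for t ≥ 6, so the truncated subtractions ∸ are genuine)
Qpoly : ℕ → Poly
Qpoly t = sumₚ
  ( mono two (2 * t + 1) ∷ mono mtwo (2 * t ∸ 1) ∷ mono two (2 * t ∸ 2)
  ∷ mono one (t + 3) ∷ mono mone (t + 2) ∷ mono one (t ∸ 1) ∷ mono mone (t ∸ 2)
  ∷ mono mtwo 3 ∷ mono two 2 ∷ mono mtwo 0 ∷ [])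
  where open import Data.Nat using (_*_)

Rpoly : ℕ → Poly
Rpoly t = sumₚ
  ( mono two (2 * t + 1) ∷ mono mtwo (2 * t ∸ 1) ∷ mono two (2 * t ∸ 2)
  ∷ mono mone (t + 3) ∷ mono one (t + 2) ∷ mono mfour (t + 1) ∷ mono four t
  ∷ mono mone (t ∸ 1) ∷ mono one (t ∸ 2)
  ∷ mono mtwo 3 ∷ mono two 2 ∷ mono mtwo 0 ∷ [])
  where open import Data.Nat using (_*_)

-- Cyclotomic polynomials at the indices needed (p an odd prime):
-- Φ_p(x)  = 1 + x + ... + x^{p-1}
Φ-p : ℕ → Poly
Φ-p p = replicate p 1ℚ

-- Φ_{2p}(x) = Φ_p(-x) = 1 - x + x^2 - ... + x^{p-1}   (p odd)
alt : ℕ → Poly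
alt zero    = []
alt (suc n) = 1ℚ ∷ negs n
  where
  negs : ℕ → Poly
  negs zero    = []
  negs (suc m) = (- 1ℚ) ∷ alt m

Φ-2p : ℕ → Poly
Φ-2p p = alt p

-- Reduce modulo 2 without leaving ℚ. For odd p, Φ_p(x) and Φ_2p(x) are
-- G(x) = Σ_{i<p} (cx)^i with c = 1 and c = -1. If G·g = f, the partial sums
-- T m = Σ_{i<m} c^i g_i of g(c) satisfy T (n+1) = c^n f_n + T (n+1-p), so g(c) is a
-- signed sum of the coefficients of f along one residue class mod p. The odd
-- coefficients of Q_t and R_t sit at t-2, t-1, t+2, t+3, a window shorter than p, so
-- along the class of t+3 only f_{t+3} is odd and g(c) is an odd integer. Then
-- f(c) = G(c)·g(c) = p·g(c) is odd, whereas f(±1) is even: f has four odd coefficients.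

module Submission where

open import Defs
open import Data.Nat using (ℕ; _≤_)
open import Data.Nat.Divisibility using (_∣_)
open import Data.Nat.Primality using (Prime)
open import Data.Product using (_×_)
open import Relation.Nullary using (¬_)

open import Data.Bool using (Bool; true; false; _xor_; _∧_)
open import Data.Integer as ℤ using (ℤ; +_; -[1+_]; ∣_∣)
import Data.Integer.Properties as ℤ
open import Data.Integer.Tactic.RingSolver using () renaming (ring to ℤ-ring)
open import Data.List using (List; []; _∷_; foldr; length; map; take)
open import Data.List.Properties using (take-all)
open import Data.List.Relation.Binary.Pointwise using (Pointwise; []; _∷_)
open import Data.Nat as ℕ using (zero; suc; _<_; _∸_; NonZero; _≤?_)
import Data.Nat.Properties as ℕ
open import Data.Nat.Divisibility using (divides; ∣-refl; ∣m∣n⇒∣m+n)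
open import Data.Nat.Induction using (<-wellFounded)
open import Data.Nat.Primality using (prime⇒irreducible)
open import Data.Product using (∃-syntax; _,_; proj₁; uncurry)
open import Data.Rational as ℚ using (ℚ; 0ℚ; 1ℚ; _/_; _+_; _*_; -_; toℚᵘ)
import Data.Rational.Properties as ℚ
open import Algebra.Definitions.RawSemiring ℚ.+-*-rawSemiring using (_^_)
import Data.Rational.Unnormalised as ℚᵘ
import Data.Rational.Unnormalised.Properties as ℚᵘ
open import Data.Sum using (_⊎_; inj₁; inj₂)
open import Function using (_∘_)
open import Induction.WellFounded using (Acc; acc)
open import Level using (0ℓ)
open import Relation.Binary.PropositionalEquality
open import Relation.Nullary using (yes; no; contradiction)
open import Relation.Nullary.Decidable using (dec⇒maybe)
open import Tactic.RingSolver using (solve-∀)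
open import Tactic.RingSolver.Core.AlmostCommutativeRing using (AlmostCommutativeRing; fromCommutativeRing)

ℚ-ring : AlmostCommutativeRing 0ℓ 0ℓ
ℚ-ring = fromCommutativeRing ℚ.+-*-commutativeRing (λ x → dec⇒maybe (0ℚ ℚ.≟ x))

fromℤ : ℤ → ℚ
fromℤ z = z / 1

toℚᵘ-fromℤ : ∀ z → toℚᵘ (fromℤ z) ℚᵘ.≃ ℚᵘ.mkℚᵘ z 0
toℚᵘ-fromℤ z = ℚ.toℚᵘ-fromℚᵘ (ℚᵘ.mkℚᵘ z 0)

fromℤ-injective : ∀ {x y} → fromℤ x ≡ fromℤ y → x ≡ y
fromℤ-injective {x} {y} eq with ℚ.fromℚᵘ-injective {ℚᵘ.mkℚᵘ x 0} {ℚᵘ.mkℚᵘ y 0} eq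
... | ℚᵘ.*≡* x*1≡y*1 = begin
  x         ≡⟨ ℤ.*-identityʳ x ⟨
  x ℤ.* + 1 ≡⟨ x*1≡y*1 ⟩
  y ℤ.* + 1 ≡⟨ ℤ.*-identityʳ y ⟩
  y         ∎
  where open ≡-Reasoning

fromℤ-+ : ∀ x y → fromℤ x + fromℤ y ≡ fromℤ (x ℤ.+ y)
fromℤ-+ x y = ℚ.toℚᵘ-injective (begin
  toℚᵘ (fromℤ x + fromℤ y)            ≈⟨ ℚ.toℚᵘ-homo-+ (fromℤ x) (fromℤ y) ⟩
  toℚᵘ (fromℤ x) ℚᵘ.+ toℚᵘ (fromℤ y)  ≈⟨ ℚᵘ.+-cong (toℚᵘ-fromℤ x) (toℚᵘ-fromℤ y) ⟩
  ℚᵘ.mkℚᵘ x 0 ℚᵘ.+ ℚᵘ.mkℚᵘ y 0        ≈⟨ ℚᵘ.*≡* (numerators x y) ⟩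
  ℚᵘ.mkℚᵘ (x ℤ.+ y) 0                 ≈⟨ toℚᵘ-fromℤ (x ℤ.+ y) ⟨
  toℚᵘ (fromℤ (x ℤ.+ y))              ∎)
  where
  open ℚᵘ.≃-Reasoning
  numerators : ∀ x y → (x ℤ.* + 1 ℤ.+ y ℤ.* + 1) ℤ.* + 1 ≡ (x ℤ.+ y) ℤ.* + 1
  numerators = solve-∀ ℤ-ring

fromℤ-* : ∀ x y → fromℤ x * fromℤ y ≡ fromℤ (x ℤ.* y)
fromℤ-* x y = ℚ.toℚᵘ-injective (begin
  toℚᵘ (fromℤ x * fromℤ y)            ≈⟨ ℚ.toℚᵘ-homo-* (fromℤ x) (fromℤ y) ⟩
  toℚᵘ (fromℤ x) ℚᵘ.* toℚᵘ (fromℤ y)  ≈⟨ ℚᵘ.*-cong (toℚᵘ-fromℤ x) (toℚᵘ-fromℤ y) ⟩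
  ℚᵘ.mkℚᵘ (x ℤ.* y) 0                 ≈⟨ toℚᵘ-fromℤ (x ℤ.* y) ⟨
  toℚᵘ (fromℤ (x ℤ.* y))              ∎)
  where open ℚᵘ.≃-Reasoning

bit : Bool → ℤ
bit false = + 0
bit true  = + 1

bit-+ : ∀ a b → bit a ℤ.+ bit b ≡ bit (a xor b) ℤ.+ + 2 ℤ.* bit (a ∧ b)
bit-+ false false = refl
bit-+ false true  = refl
bit-+ true  false = refl
bit-+ true  true  = refl

-- A record rather than a Σ-type, so that b and x are recovered by unification.
record Parity (b : Bool) (x : ℚ) : Set where
  constructor _,_
  field
    half : ℤ
    integral : x ≡ fromℤ (bit b ℤ.+ + 2 ℤ.* half)

Even Odd : ℚ → Set
Even = Parity false
Odd  = Parity true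

even-0 : Even 0ℚ
even-0 = + 0 , refl

2*≢1 : ∀ z → + 2 ℤ.* z ≢ + 1
2*≢1 z 2z≡1 with ℕ.m*n≡1⇒m≡1 2 ∣ z ∣ (trans (sym (ℤ.abs-* (+ 2) z)) (cong ∣_∣ 2z≡1))
... | ()

even⇒¬odd : ∀ {x} → Even x → ¬ Odd x
even⇒¬odd (w , refl) (v , eq) = 2*≢1 (w ℤ.- v) (begin
  + 2 ℤ.* (w ℤ.- v)                  ≡⟨ shift w v ⟩
  (+ 0 ℤ.+ + 2 ℤ.* w) ℤ.- + 2 ℤ.* v  ≡⟨ cong (ℤ._- + 2 ℤ.* v) (fromℤ-injective {+ 0 ℤ.+ + 2 ℤ.* w} {+ 1 ℤ.+ + 2 ℤ.* v} eq) ⟩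
  (+ 1 ℤ.+ + 2 ℤ.* v) ℤ.- + 2 ℤ.* v  ≡⟨ cancel v ⟩
  + 1                                ∎)
  where
  open ≡-Reasoning
  shift : ∀ w v → + 2 ℤ.* (w ℤ.- v) ≡ (+ 0 ℤ.+ + 2 ℤ.* w) ℤ.- + 2 ℤ.* v
  shift = solve-∀ ℤ-ring
  cancel : ∀ v → (+ 1 ℤ.+ + 2 ℤ.* v) ℤ.- + 2 ℤ.* v ≡ + 1
  cancel = solve-∀ ℤ-ring

parity-+ : ∀ {a b x y} → Parity a x → Parity b y → Parity (a xor b) (x + y)
parity-+ {a} {b} (w , refl) (v , refl) = w ℤ.+ v ℤ.+ bit (a ∧ b) , (begin
  fromℤ (bit a ℤ.+ + 2 ℤ.* w) + fromℤ (bit b ℤ.+ + 2 ℤ.* v)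
    ≡⟨ fromℤ-+ (bit a ℤ.+ + 2 ℤ.* w) (bit b ℤ.+ + 2 ℤ.* v) ⟩
  fromℤ ((bit a ℤ.+ + 2 ℤ.* w) ℤ.+ (bit b ℤ.+ + 2 ℤ.* v))
    ≡⟨ cong fromℤ (regroup (bit a) (bit b) w v) ⟩
  fromℤ ((bit a ℤ.+ bit b) ℤ.+ + 2 ℤ.* (w ℤ.+ v))
    ≡⟨ cong (λ z → fromℤ (z ℤ.+ + 2 ℤ.* (w ℤ.+ v))) (bit-+ a b) ⟩
  fromℤ ((bit (a xor b) ℤ.+ + 2 ℤ.* bit (a ∧ b)) ℤ.+ + 2 ℤ.* (w ℤ.+ v))
    ≡⟨ cong fromℤ (collect (bit (a xor b)) (bit (a ∧ b)) w v) ⟩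
  fromℤ (bit (a xor b) ℤ.+ + 2 ℤ.* (w ℤ.+ v ℤ.+ bit (a ∧ b)))
    ∎)
  where
  open ≡-Reasoning
  regroup : ∀ a b w v → (a ℤ.+ + 2 ℤ.* w) ℤ.+ (b ℤ.+ + 2 ℤ.* v) ≡ (a ℤ.+ b) ℤ.+ + 2 ℤ.* (w ℤ.+ v)
  regroup = solve-∀ ℤ-ring
  collect : ∀ s c w v → (s ℤ.+ + 2 ℤ.* c) ℤ.+ + 2 ℤ.* (w ℤ.+ v) ≡ s ℤ.+ + 2 ℤ.* (w ℤ.+ v ℤ.+ c)
  collect = solve-∀ ℤ-ring

odd-* : ∀ {x y} → Odd x → Odd y → Odd (x * y)
odd-* (w , refl) (v , refl) = w ℤ.+ v ℤ.+ + 2 ℤ.* w ℤ.* v ,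
  trans (fromℤ-* (+ 1 ℤ.+ + 2 ℤ.* w) (+ 1 ℤ.+ + 2 ℤ.* v)) (cong fromℤ (expand w v))
  where
  expand : ∀ w v → (+ 1 ℤ.+ + 2 ℤ.* w) ℤ.* (+ 1 ℤ.+ + 2 ℤ.* v) ≡ + 1 ℤ.+ + 2 ℤ.* (w ℤ.+ v ℤ.+ + 2 ℤ.* w ℤ.* v)
  expand = solve-∀ ℤ-ring

Sign : ℚ → Set
Sign c = c ≡ 1ℚ ⊎ c ≡ - 1ℚ

sign-* : ∀ {a b} → Sign a → Sign b → Sign (a * b)
sign-* (inj₁ refl) (inj₁ refl) = inj₁ refl
sign-* (inj₁ refl) (inj₂ refl) = inj₂ refl
sign-* (inj₂ refl) (inj₁ refl) = inj₂ refl
sign-* (inj₂ refl) (inj₂ refl) = inj₁ refl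

sign-^ : ∀ {c} → Sign c → ∀ n → Sign (c ^ n)
sign-^ c-sign zero    = inj₁ refl
sign-^ c-sign (suc n) = sign-* c-sign (sign-^ c-sign n)

sign*sign≡1 : ∀ {c} → Sign c → c * c ≡ 1ℚ
sign*sign≡1 (inj₁ refl) = refl
sign*sign≡1 (inj₂ refl) = refl

sign-*-parity : ∀ {u b x} → Sign u → Parity b x → Parity b (u * x)
sign-*-parity {b = b} {x} (inj₁ refl) x-parity = subst (Parity b) (sym (ℚ.*-identityˡ x)) x-parity
sign-*-parity {b = b} (inj₂ refl) (w , refl) = ℤ.- w ℤ.- bit b ,
  trans (fromℤ-* -[1+ 0 ] (bit b ℤ.+ + 2 ℤ.* w)) (cong fromℤ (negate (bit b) w))
  where
  negate : ∀ s w → -[1+ 0 ] ℤ.* (s ℤ.+ + 2 ℤ.* w) ≡ s ℤ.+ + 2 ℤ.* (ℤ.- w ℤ.- s)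
  negate = solve-∀ ℤ-ring

¬2∣⇒odd : ∀ n → ¬ 2 ∣ n → ∃[ k ] n ≡ suc (2 ℕ.* k)
¬2∣⇒odd zero          ¬2∣n = contradiction (divides 0 refl) ¬2∣n
¬2∣⇒odd (suc zero)    ¬2∣n = 0 , refl
¬2∣⇒odd (suc (suc n)) ¬2∣n with ¬2∣⇒odd n (¬2∣n ∘ ∣m∣n⇒∣m+n ∣-refl)
... | k , refl = suc k , cong (suc ∘ suc) (sym (ℕ.+-suc k (k ℕ.+ 0)))

odd-fromℕ : ∀ k → Odd (fromℤ (+ suc (2 ℕ.* k)))
odd-fromℕ k = + k , cong (λ z → fromℤ (+ 1 ℤ.+ z)) (ℤ.pos-* 2 k)

eval : ℚ → Poly → ℚ
eval c []      = 0ℚ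
eval c (a ∷ f) = a + c * eval c f

coeff-+ₚ : ∀ f g n → coeff (f +ₚ g) n ≡ coeff f n + coeff g n
coeff-+ₚ []      g       n       = sym (ℚ.+-identityˡ (coeff g n))
coeff-+ₚ (a ∷ f) []      n       = sym (ℚ.+-identityʳ (coeff (a ∷ f) n))
coeff-+ₚ (a ∷ f) (b ∷ g) zero    = refl
coeff-+ₚ (a ∷ f) (b ∷ g) (suc n) = coeff-+ₚ f g n

coeff-scaleₚ : ∀ a f n → coeff (scaleₚ a f) n ≡ a * coeff f n
coeff-scaleₚ a []      n       = sym (ℚ.*-zeroʳ a)
coeff-scaleₚ a (b ∷ f) zero    = refl
coeff-scaleₚ a (b ∷ f) (suc n) = coeff-scaleₚ a f n

coeff-∷-*ₚ : ∀ a f g n → coeff ((a ∷ f) *ₚ g) n ≡ a * coeff g n + coeff (0ℚ ∷ f *ₚ g) n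
coeff-∷-*ₚ a f g n =
  trans (coeff-+ₚ (scaleₚ a g) (0ℚ ∷ f *ₚ g) n) (cong (_+ coeff (0ℚ ∷ f *ₚ g) n) (coeff-scaleₚ a g n))

coeff-scaleₚ-*ₚ : ∀ a f g n → coeff (scaleₚ a f *ₚ g) n ≡ a * coeff (f *ₚ g) n
coeff-scaleₚ-*ₚ a []      g n = sym (ℚ.*-zeroʳ a)
coeff-scaleₚ-*ₚ a (b ∷ f) g n = begin
  coeff (scaleₚ a (b ∷ f) *ₚ g) n                       ≡⟨ coeff-∷-*ₚ (a * b) (scaleₚ a f) g n ⟩
  a * b * coeff g n + coeff (0ℚ ∷ scaleₚ a f *ₚ g) n    ≡⟨ cong (λ x → a * b * coeff g n + x) (shifted n) ⟩
  a * b * coeff g n + a * coeff (0ℚ ∷ f *ₚ g) n         ≡⟨ factor a b (coeff g n) (coeff (0ℚ ∷ f *ₚ g) n) ⟩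
  a * (b * coeff g n + coeff (0ℚ ∷ f *ₚ g) n)           ≡⟨ cong (a *_) (coeff-∷-*ₚ b f g n) ⟨
  a * coeff ((b ∷ f) *ₚ g) n                            ∎
  where
  open ≡-Reasoning
  shifted : ∀ n → coeff (0ℚ ∷ scaleₚ a f *ₚ g) n ≡ a * coeff (0ℚ ∷ f *ₚ g) n
  shifted zero    = sym (ℚ.*-zeroʳ a)
  shifted (suc n) = coeff-scaleₚ-*ₚ a f g n
  factor : ∀ a b x y → a * b * x + a * y ≡ a * (b * x + y)
  factor = solve-∀ ℚ-ring

eval-+ₚ : ∀ c f g → eval c (f +ₚ g) ≡ eval c f + eval c g
eval-+ₚ c []      g       = sym (ℚ.+-identityˡ (eval c g))
eval-+ₚ c (a ∷ f) []      = sym (ℚ.+-identityʳ (eval c (a ∷ f)))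
eval-+ₚ c (a ∷ f) (b ∷ g) =
  trans (cong (λ x → a + b + c * x) (eval-+ₚ c f g)) (regroup a b c (eval c f) (eval c g))
  where
  regroup : ∀ a b c x y → a + b + c * (x + y) ≡ (a + c * x) + (b + c * y)
  regroup = solve-∀ ℚ-ring

eval-scaleₚ : ∀ c a f → eval c (scaleₚ a f) ≡ a * eval c f
eval-scaleₚ c a []      = sym (ℚ.*-zeroʳ a)
eval-scaleₚ c a (b ∷ f) =
  trans (cong (λ x → a * b + c * x) (eval-scaleₚ c a f)) (regroup a b c (eval c f))
  where
  regroup : ∀ a b c x → a * b + c * (a * x) ≡ a * (b + c * x)
  regroup = solve-∀ ℚ-ring

eval-*ₚ : ∀ c f g → eval c (f *ₚ g) ≡ eval c f * eval c g
eval-*ₚ c []      g = sym (ℚ.*-zeroˡ (eval c g))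
eval-*ₚ c (a ∷ f) g = begin
  eval c (scaleₚ a g +ₚ (0ℚ ∷ f *ₚ g))               ≡⟨ eval-+ₚ c (scaleₚ a g) (0ℚ ∷ f *ₚ g) ⟩
  eval c (scaleₚ a g) + (0ℚ + c * eval c (f *ₚ g))   ≡⟨ cong₂ (λ x y → x + (0ℚ + c * y)) (eval-scaleₚ c a g) (eval-*ₚ c f g) ⟩
  a * eval c g + (0ℚ + c * (eval c f * eval c g))    ≡⟨ regroup a c (eval c f) (eval c g) ⟩
  (a + c * eval c f) * eval c g                      ∎
  where
  open ≡-Reasoning
  regroup : ∀ a c x y → a * y + (0ℚ + c * (x * y)) ≡ (a + c * x) * y
  regroup = solve-∀ ℚ-ring

eval-[]≈ : ∀ c g → [] ≈ₚ g → 0ℚ ≡ eval c g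
eval-[]≈ c []      _    = refl
eval-[]≈ c (b ∷ g) []≈g = begin
  0ℚ               ≡⟨ zero-poly c ⟩
  0ℚ + c * 0ℚ      ≡⟨ cong₂ (λ x y → x + c * y) ([]≈g 0) (eval-[]≈ c g ([]≈g ∘ suc)) ⟩
  b + c * eval c g ∎
  where
  open ≡-Reasoning
  zero-poly : ∀ c → 0ℚ ≡ 0ℚ + c * 0ℚ
  zero-poly = solve-∀ ℚ-ring

eval-cong : ∀ c {f g} → f ≈ₚ g → eval c f ≡ eval c g
eval-cong c {[]}    {g}     f≈g = eval-[]≈ c g f≈g
eval-cong c {a ∷ f} {[]}    f≈g = sym (eval-[]≈ c (a ∷ f) (sym ∘ f≈g))
eval-cong c {a ∷ f} {b ∷ g} f≈g = cong₂ (λ x y → x + c * y) (f≈g 0) (eval-cong c {f} {g} (f≈g ∘ suc))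

eval-take-suc : ∀ c g n → eval c (take (suc n) g) ≡ eval c (take n g) + c ^ n * coeff g n
eval-take-suc c []      zero    = zero-tail 1ℚ
  where
  zero-tail : ∀ y → 0ℚ ≡ 0ℚ + y * 0ℚ
  zero-tail = solve-∀ ℚ-ring
eval-take-suc c []      (suc n) = zero-tail (c ^ suc n)
  where
  zero-tail : ∀ y → 0ℚ ≡ 0ℚ + y * 0ℚ
  zero-tail = solve-∀ ℚ-ring
eval-take-suc c (a ∷ g) zero    = constant a c
  where
  constant : ∀ a c → a + c * 0ℚ ≡ 0ℚ + 1ℚ * a
  constant = solve-∀ ℚ-ring
eval-take-suc c (a ∷ g) (suc n) =
  trans (cong (λ x → a + c * x) (eval-take-suc c g n)) (regroup a c (eval c (take n g)) (c ^ n) (coeff g n))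
  where
  regroup : ∀ a c x y z → a + c * (x + y * z) ≡ (a + c * x) + c * y * z
  regroup = solve-∀ ℚ-ring

geometric : ℚ → ℕ → Poly
geometric c zero    = []
geometric c (suc p) = 1ℚ ∷ scaleₚ c (geometric c p)

scaleₚ-identity : ∀ f → scaleₚ 1ℚ f ≡ f
scaleₚ-identity []      = refl
scaleₚ-identity (a ∷ f) = cong₂ _∷_ (ℚ.*-identityˡ a) (scaleₚ-identity f)

scaleₚ-scaleₚ : ∀ a b f → scaleₚ a (scaleₚ b f) ≡ scaleₚ (a * b) f
scaleₚ-scaleₚ a b []      = refl
scaleₚ-scaleₚ a b (x ∷ f) = cong₂ _∷_ (sym (ℚ.*-assoc a b x)) (scaleₚ-scaleₚ a b f)

Φ-p≡geometric : ∀ p → Φ-p p ≡ geometric 1ℚ p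
Φ-p≡geometric zero    = refl
Φ-p≡geometric (suc p) = cong (1ℚ ∷_) (trans (Φ-p≡geometric p) (sym (scaleₚ-identity (geometric 1ℚ p))))

Φ-2p≡geometric : ∀ p → Φ-2p p ≡ geometric (- 1ℚ) p
Φ-2p≡geometric zero          = refl
Φ-2p≡geometric (suc zero)    = refl
Φ-2p≡geometric (suc (suc p)) = cong (λ f → 1ℚ ∷ - 1ℚ ∷ f) (begin
  Φ-2p p                                           ≡⟨ Φ-2p≡geometric p ⟩
  G                                                ≡⟨ scaleₚ-identity G ⟨
  scaleₚ 1ℚ G                                      ≡⟨ scaleₚ-scaleₚ (- 1ℚ) (- 1ℚ) G ⟨
  scaleₚ (- 1ℚ) (scaleₚ (- 1ℚ) G)                  ∎)
  where
  open ≡-Reasoning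
  G : Poly
  G = geometric (- 1ℚ) p

eval-geometric : ∀ {c} → c * c ≡ 1ℚ → ∀ p → eval c (geometric c p) ≡ fromℤ (+ p)
eval-geometric c*c≡1 zero = refl
eval-geometric {c} c*c≡1 (suc p) = begin
  1ℚ + c * eval c (scaleₚ c G)   ≡⟨ cong (λ x → 1ℚ + c * x) (eval-scaleₚ c c G) ⟩
  1ℚ + c * (c * eval c G)        ≡⟨ cong (λ x → 1ℚ + x) (ℚ.*-assoc c c (eval c G)) ⟨
  1ℚ + c * c * eval c G          ≡⟨ cong (λ x → 1ℚ + x * eval c G) c*c≡1 ⟩
  1ℚ + 1ℚ * eval c G             ≡⟨ cong (λ x → 1ℚ + x) (ℚ.*-identityˡ (eval c G)) ⟩
  1ℚ + eval c G                  ≡⟨ cong (λ x → 1ℚ + x) (eval-geometric c*c≡1 p) ⟩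
  fromℤ (+ 1) + fromℤ (+ p)      ≡⟨ fromℤ-+ (+ 1) (+ p) ⟩
  fromℤ (+ suc p)                ∎
  where
  open ≡-Reasoning
  G : Poly
  G = geometric c p

-- For n < p, truncated subtraction makes the last summand eval c (take 0 g) = 0.
eval-take-geometric-*ₚ : ∀ {c} → c * c ≡ 1ℚ → ∀ p g n →
  eval c (take (suc n) g) ≡ c ^ n * coeff (geometric c p *ₚ g) n + eval c (take (suc n ∸ p) g)
eval-take-geometric-*ₚ {c} c*c≡1 zero g n = no-term (c ^ n) (eval c (take (suc n) g))
  where
  no-term : ∀ y x → x ≡ y * 0ℚ + x
  no-term = solve-∀ ℚ-ring
eval-take-geometric-*ₚ {c} c*c≡1 (suc p) g zero = begin
  eval c (take 1 g)                                   ≡⟨ eval-take-suc c g 0 ⟩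
  0ℚ + 1ℚ * coeff g 0                                 ≡⟨ constant (coeff g 0) ⟩
  1ℚ * (1ℚ * coeff g 0 + 0ℚ) + 0ℚ                     ≡⟨ cong₂ (λ x m → 1ℚ * x + eval c (take m g))
                                                             (coeff-∷-*ₚ 1ℚ (scaleₚ c (geometric c p)) g 0) (ℕ.0∸n≡0 p) ⟨
  1ℚ * coeff (geometric c (suc p) *ₚ g) 0 + eval c (take (0 ∸ p) g) ∎
  where
  open ≡-Reasoning
  constant : ∀ x → 0ℚ + 1ℚ * x ≡ 1ℚ * (1ℚ * x + 0ℚ) + 0ℚ
  constant = solve-∀ ℚ-ring
eval-take-geometric-*ₚ {c} c*c≡1 (suc p) g (suc n) = begin
  eval c (take (suc (suc n)) g)             ≡⟨ eval-take-suc c g (suc n) ⟩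
  eval c (take (suc n) g) + c * y * x       ≡⟨ cong (λ t → t + c * y * x) (eval-take-geometric-*ₚ c*c≡1 p g n) ⟩
  y * X + T + c * y * x                     ≡⟨ unit (y * X) T (c * y * x) ⟩
  1ℚ * (y * X) + T + c * y * x              ≡⟨ cong (λ u → u * (y * X) + T + c * y * x) c*c≡1 ⟨
  c * c * (y * X) + T + c * y * x           ≡⟨ regroup c y X T x ⟩
  c * y * (1ℚ * x + c * X) + T              ≡⟨ cong (λ z → c * y * z + T) coeff-step ⟨
  c ^ suc n * coeff (geometric c (suc p) *ₚ g) (suc n) + T ∎
  where
  open ≡-Reasoning
  y x X T : ℚ
  y = c ^ n
  x = coeff g (suc n)
  X = coeff (geometric c p *ₚ g) n
  T = eval c (take (suc n ∸ p) g)
  unit : ∀ a b d → a + b + d ≡ 1ℚ * a + b + d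
  unit = solve-∀ ℚ-ring
  regroup : ∀ c y X T x → c * c * (y * X) + T + c * y * x ≡ c * y * (1ℚ * x + c * X) + T
  regroup = solve-∀ ℚ-ring
  coeff-step : coeff (geometric c (suc p) *ₚ g) (suc n) ≡ 1ℚ * x + c * X
  coeff-step = trans (coeff-∷-*ₚ 1ℚ (scaleₚ c (geometric c p)) g (suc n))
                     (cong (λ z → 1ℚ * x + z) (coeff-scaleₚ-*ₚ c (geometric c p) g n))

odd-on-residue-class : (T s a : ℕ → ℚ) (p : ℕ) .{{_ : NonZero p}} →
  T 0 ≡ 0ℚ → (∀ n → Sign (s n)) → (∀ n → T (suc n) ≡ s n * a n + T (suc n ∸ p)) →
  ∀ r → Odd (a r) → (∀ n → r < n ⊎ n ℕ.+ p ≤ r → Even (a n)) →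
  ∀ k → Odd (T (suc (k ℕ.* p ℕ.+ r)))
odd-on-residue-class T s a p T0≡0 s-sign T-step r a-odd a-even = odd-above
  where
  step : ∀ {x y} n → Parity x (a n) → Parity y (T (suc n ∸ p)) → Parity (x xor y) (T (suc n))
  step n a-parity T-parity =
    subst (Parity _) (sym (T-step n)) (parity-+ (sign-*-parity (s-sign n) a-parity) T-parity)

  even-below : ∀ n → Acc _<_ n → n ≤ r → Even (T (suc n ∸ p))
  even-below n (acc rec) n≤r with p ≤? n
  ... | no  p≰n = subst (Even ∘ T) (sym (ℕ.m≤n⇒m∸n≡0 (ℕ.≰⇒> p≰n))) (subst Even (sym T0≡0) even-0)
  ... | yes p≤n = subst (Even ∘ T) (sym (ℕ.+-∸-assoc 1 p≤n))
    (step (n ∸ p) (a-even (n ∸ p) (inj₂ (subst (_≤ r) (sym (ℕ.m∸n+n≡m p≤n)) n≤r)))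
                  (even-below (n ∸ p) (rec (ℕ.∸-monoʳ-< (ℕ.>-nonZero⁻¹ p) p≤n))
                                      (ℕ.≤-trans (ℕ.m∸n≤m n p) n≤r)))

  odd-above : ∀ k → Odd (T (suc (k ℕ.* p ℕ.+ r)))
  odd-above zero    = step r a-odd (even-below r (<-wellFounded r) ℕ.≤-refl)
  odd-above (suc k) = step n (a-even n (inj₁ r<n)) (subst (Odd ∘ T) (sym previous) (odd-above k))
    where
    open ≡-Reasoning
    n : ℕ
    n = suc k ℕ.* p ℕ.+ r
    r<n : r < n
    r<n = ℕ.m<n+m r (ℕ.<-≤-trans (ℕ.>-nonZero⁻¹ p) (ℕ.m≤m+n p (k ℕ.* p)))
    previous : suc n ∸ p ≡ suc (k ℕ.* p ℕ.+ r)
    previous = begin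
      suc (p ℕ.+ k ℕ.* p ℕ.+ r) ∸ p     ≡⟨ cong (λ m → suc m ∸ p) (ℕ.+-assoc p (k ℕ.* p) r) ⟩
      suc (p ℕ.+ (k ℕ.* p ℕ.+ r)) ∸ p   ≡⟨ cong (_∸ p) (ℕ.+-suc p (k ℕ.* p ℕ.+ r)) ⟨
      p ℕ.+ suc (k ℕ.* p ℕ.+ r) ∸ p     ≡⟨ ℕ.m+n∸m≡n p (suc (k ℕ.* p ℕ.+ r)) ⟩
      suc (k ℕ.* p ℕ.+ r)               ∎

geometric-quotient-odd : ∀ {c p r f g} .{{_ : NonZero p}} → Sign c → (geometric c p *ₚ g) ≈ₚ f →
  Odd (coeff f r) → (∀ n → r < n ⊎ n ℕ.+ p ≤ r → Even (coeff f n)) → Odd (eval c g)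
geometric-quotient-odd {c} {p} {r} {f} {g} c-sign Φg≈f f-odd f-even =
  subst Odd (cong (eval c) (take-all (suc (length g ℕ.* p ℕ.+ r)) g long-enough))
    (odd-on-residue-class (λ m → eval c (take m g)) (c ^_) (coeff f) p refl (sign-^ c-sign) recurrence
                          r f-odd f-even (length g))
  where
  recurrence : ∀ n → eval c (take (suc n) g) ≡ c ^ n * coeff f n + eval c (take (suc n ∸ p) g)
  recurrence n = trans (eval-take-geometric-*ₚ (sign*sign≡1 c-sign) p g n)
                       (cong (λ x → c ^ n * x + eval c (take (suc n ∸ p) g)) (Φg≈f n))
  long-enough : length g ≤ suc (length g ℕ.* p ℕ.+ r)
  long-enough = ℕ.≤-trans (ℕ.m≤m*n (length g) p) (ℕ.≤-trans (ℕ.m≤m+n _ r) (ℕ.n≤1+n _))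

geometric∤ : ∀ {c p r f} → Sign c → ¬ 2 ∣ p →
  Odd (coeff f r) → (∀ n → r < n ⊎ n ℕ.+ p ≤ r → Even (coeff f n)) → Even (eval c f) →
  ¬ (geometric c p ∣ₚ f)
geometric∤ {c} {p} {r} {f} c-sign ¬2∣p f-odd f-even f[c]-even (g , Φg≈f) with ¬2∣⇒odd p ¬2∣p
... | k , refl = even⇒¬odd f[c]-even
  (subst Odd factor (odd-* (odd-fromℕ k) (geometric-quotient-odd {f = f} {g = g} c-sign Φg≈f f-odd f-even)))
  where
  open ≡-Reasoning
  factor : fromℤ (+ p) * eval c g ≡ eval c f
  factor = begin
    fromℤ (+ p) * eval c g                  ≡⟨ cong (_* eval c g) (eval-geometric {c} (sign*sign≡1 c-sign) p) ⟨
    eval c (geometric c p) * eval c g       ≡⟨ eval-*ₚ c (geometric c p) g ⟨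
    eval c (geometric c p *ₚ g)             ≡⟨ eval-cong c {geometric c p *ₚ g} {f} Φg≈f ⟩
    eval c f                                ∎

coeff-mono-≡ : ∀ z k → coeff (mono z k) k ≡ fromℤ z
coeff-mono-≡ z zero    = refl
coeff-mono-≡ z (suc k) = coeff-mono-≡ z k

coeff-mono-≢ : ∀ z {k n} → n ≢ k → coeff (mono z k) n ≡ 0ℚ
coeff-mono-≢ z {zero}  {zero}  n≢k = contradiction refl n≢k
coeff-mono-≢ z {zero}  {suc n} _   = refl
coeff-mono-≢ z {suc k} {zero}  _   = refl
coeff-mono-≢ z {suc k} {suc n} n≢k = coeff-mono-≢ z (n≢k ∘ cong suc)

eval-mono : ∀ c z k → eval c (mono z k) ≡ c ^ k * fromℤ z
eval-mono c z zero    = constant (fromℤ z) c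
  where
  constant : ∀ a c → a + c * 0ℚ ≡ 1ℚ * a
  constant = solve-∀ ℚ-ring
eval-mono c z (suc k) = trans (cong (λ x → 0ℚ + c * x) (eval-mono c z k)) (regroup c (c ^ k) (fromℤ z))
  where
  regroup : ∀ c y a → 0ℚ + c * (y * a) ≡ c * y * a
  regroup = solve-∀ ℚ-ring

Term : Set
Term = ℤ × ℕ

polynomial : List Term → Poly
polynomial ts = sumₚ (map (uncurry mono) ts)

-- A data type indexed by the term, so that z and k need not be inferred through coeff.
data CoeffParity (n : ℕ) : Bool → Term → Set where
  even-term : ∀ {z k} → Even (fromℤ z) → CoeffParity n false (z , k)
  term-at   : ∀ {b z} → Parity b (fromℤ z) → CoeffParity n b (z , n)
  term-off  : ∀ {z k} → n ≢ k → CoeffParity n false (z , k)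

coeff-mono-parity : ∀ {n b z k} → CoeffParity n b (z , k) → Parity b (coeff (mono z k) n)
coeff-mono-parity {n} {z = z} {k} (even-term z-even) with n ℕ.≟ k
... | yes refl = subst Even (sym (coeff-mono-≡ z k)) z-even
... | no  n≢k  = subst Even (sym (coeff-mono-≢ z n≢k)) even-0
coeff-mono-parity {n} {b} {z} (term-at z-parity) = subst (Parity b) (sym (coeff-mono-≡ z n)) z-parity
coeff-mono-parity {z = z} (term-off n≢k) = subst Even (sym (coeff-mono-≢ z n≢k)) even-0

coeff-polynomial-parity : ∀ n ts {bs} → Pointwise (CoeffParity n) bs ts →
  Parity (foldr _xor_ false bs) (coeff (polynomial ts) n)
coeff-polynomial-parity n []             []       = even-0
coeff-polynomial-parity n ((z , k) ∷ ts) (p ∷ ps) =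
  subst (Parity _) (sym (coeff-+ₚ (mono z k) (polynomial ts) n))
    (parity-+ (coeff-mono-parity p) (coeff-polynomial-parity n ts ps))

eval-polynomial-parity : ∀ {c} → Sign c → ∀ ts {bs} → Pointwise (λ b t → Parity b (fromℤ (proj₁ t))) bs ts →
  Parity (foldr _xor_ false bs) (eval c (polynomial ts))
eval-polynomial-parity c-sign []             []       = even-0
eval-polynomial-parity {c} c-sign ((z , k) ∷ ts) (p ∷ ps) =
  subst (Parity _) (sym (eval-+ₚ c (mono z k) (polynomial ts)))
    (parity-+ (subst (Parity _) (sym (eval-mono c z k)) (sign-*-parity (sign-^ c-sign k) p))
              (eval-polynomial-parity c-sign ts ps))

even-two : Even (fromℤ two)
even-two = + 1 , refl

even-mtwo : Even (fromℤ mtwo)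
even-mtwo = -[1+ 0 ] , refl

even-four : Even (fromℤ four)
even-four = + 2 , refl

even-mfour : Even (fromℤ mfour)
even-mfour = -[1+ 1 ] , refl

odd-one : Odd (fromℤ one)
odd-one = + 0 , refl

odd-mone : Odd (fromℤ mone)
odd-mone = -[1+ 0 ] , refl

t+3≢t+2 : ∀ t → t ℕ.+ 3 ≢ t ℕ.+ 2
t+3≢t+2 t = ℕ.>⇒≢ (ℕ.+-monoʳ-< t (ℕ.n<1+n 2))

t+3≢t∸ : ∀ t d → t ℕ.+ 3 ≢ t ∸ d
t+3≢t∸ t d = ℕ.>⇒≢ (ℕ.≤-<-trans (ℕ.m∸n≤m t d) (ℕ.m<m+n t ℕ.z<s))

-- The monomials of Qpoly t and Rpoly t in the order of Defs: Qpoly t and Rpoly t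
-- reduce to polynomial (Qterms t) and polynomial (Rterms t).
Qterms Rterms : ℕ → List Term
Qterms t =
  (two , 2 ℕ.* t ℕ.+ 1) ∷ (mtwo , 2 ℕ.* t ∸ 1) ∷ (two , 2 ℕ.* t ∸ 2)
  ∷ (one , t ℕ.+ 3) ∷ (mone , t ℕ.+ 2) ∷ (one , t ∸ 1) ∷ (mone , t ∸ 2)
  ∷ (mtwo , 3) ∷ (two , 2) ∷ (mtwo , 0) ∷ []
Rterms t =
  (two , 2 ℕ.* t ℕ.+ 1) ∷ (mtwo , 2 ℕ.* t ∸ 1) ∷ (two , 2 ℕ.* t ∸ 2)
  ∷ (mone , t ℕ.+ 3) ∷ (one , t ℕ.+ 2) ∷ (mfour , t ℕ.+ 1) ∷ (four , t)
  ∷ (mone , t ∸ 1) ∷ (one , t ∸ 2)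
  ∷ (mtwo , 3) ∷ (two , 2) ∷ (mtwo , 0) ∷ []

Qpoly-odd-coeff : ∀ t → Odd (coeff (Qpoly t) (t ℕ.+ 3))
Qpoly-odd-coeff t = coeff-polynomial-parity (t ℕ.+ 3) (Qterms t)
  ( even-term even-two ∷ even-term even-mtwo ∷ even-term even-two
  ∷ term-at odd-one ∷ term-off (t+3≢t+2 t) ∷ term-off (t+3≢t∸ t 1) ∷ term-off (t+3≢t∸ t 2)
  ∷ even-term even-mtwo ∷ even-term even-two ∷ even-term even-mtwo ∷ [])

Qpoly-even-coeff : ∀ t n → n ≢ t ℕ.+ 3 → n ≢ t ℕ.+ 2 → n ≢ t ∸ 1 → n ≢ t ∸ 2 → Even (coeff (Qpoly t) n)
Qpoly-even-coeff t n n≢t+3 n≢t+2 n≢t-1 n≢t-2 = coeff-polynomial-parity n (Qterms t)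
  ( even-term even-two ∷ even-term even-mtwo ∷ even-term even-two
  ∷ term-off n≢t+3 ∷ term-off n≢t+2 ∷ term-off n≢t-1 ∷ term-off n≢t-2
  ∷ even-term even-mtwo ∷ even-term even-two ∷ even-term even-mtwo ∷ [])

Qpoly-even-eval : ∀ t {c} → Sign c → Even (eval c (Qpoly t))
Qpoly-even-eval t c-sign = eval-polynomial-parity c-sign (Qterms t)
  ( even-two ∷ even-mtwo ∷ even-two ∷ odd-one ∷ odd-mone ∷ odd-one ∷ odd-mone
  ∷ even-mtwo ∷ even-two ∷ even-mtwo ∷ [])

Rpoly-odd-coeff : ∀ t → Odd (coeff (Rpoly t) (t ℕ.+ 3))
Rpoly-odd-coeff t = coeff-polynomial-parity (t ℕ.+ 3) (Rterms t)
  ( even-term even-two ∷ even-term even-mtwo ∷ even-term even-two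
  ∷ term-at odd-mone ∷ term-off (t+3≢t+2 t) ∷ even-term even-mfour ∷ even-term even-four
  ∷ term-off (t+3≢t∸ t 1) ∷ term-off (t+3≢t∸ t 2)
  ∷ even-term even-mtwo ∷ even-term even-two ∷ even-term even-mtwo ∷ [])

Rpoly-even-coeff : ∀ t n → n ≢ t ℕ.+ 3 → n ≢ t ℕ.+ 2 → n ≢ t ∸ 1 → n ≢ t ∸ 2 → Even (coeff (Rpoly t) n)
Rpoly-even-coeff t n n≢t+3 n≢t+2 n≢t-1 n≢t-2 = coeff-polynomial-parity n (Rterms t)
  ( even-term even-two ∷ even-term even-mtwo ∷ even-term even-two
  ∷ term-off n≢t+3 ∷ term-off n≢t+2 ∷ even-term even-mfour ∷ even-term even-four
  ∷ term-off n≢t-1 ∷ term-off n≢t-2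
  ∷ even-term even-mtwo ∷ even-term even-two ∷ even-term even-mtwo ∷ [])

Rpoly-even-eval : ∀ t {c} → Sign c → Even (eval c (Rpoly t))
Rpoly-even-eval t c-sign = eval-polynomial-parity c-sign (Rterms t)
  ( even-two ∷ even-mtwo ∷ even-two ∷ odd-mone ∷ odd-one ∷ even-mfour ∷ even-four
  ∷ odd-mone ∷ odd-one ∷ even-mtwo ∷ even-two ∷ even-mtwo ∷ [])

window-far : ∀ {t p n k} → 6 ≤ p → t ℕ.+ 3 < n ⊎ n ℕ.+ p ≤ t ℕ.+ 3 → t ∸ 2 ≤ k → k ≤ t ℕ.+ 3 → n ≢ k
window-far _ (inj₁ t+3<n) _ k≤t+3 = ℕ.>⇒≢ (ℕ.≤-<-trans k≤t+3 t+3<n)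
window-far {t} {p} {n} 6≤p (inj₂ n+p≤t+3) t∸2≤k _ = ℕ.<⇒≢ (ℕ.<-≤-trans n<t∸2 t∸2≤k)
  where
  n+3≤t : n ℕ.+ 3 ≤ t
  n+3≤t = ℕ.+-cancelʳ-≤ 3 (n ℕ.+ 3) t
    (subst (_≤ t ℕ.+ 3) (sym (ℕ.+-assoc n 3 3)) (ℕ.≤-trans (ℕ.+-monoʳ-≤ n 6≤p) n+p≤t+3))
  n<t∸2 : n < t ∸ 2
  n<t∸2 = ℕ.m+n≤o⇒m≤o∸n (suc n) (subst (_≤ t) (ℕ.+-suc n 2) n+3≤t)

prime⇒¬2∣ : ∀ {p} → Prime p → 2 < p → ¬ 2 ∣ p
prime⇒¬2∣ p-prime 2<p 2∣p with prime⇒irreducible p-prime 2∣p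
... | inj₁ ()
... | inj₂ 2≡p = ℕ.<⇒≢ 2<p 2≡p

cyclotomic∤ : ∀ f t → Odd (coeff f (t ℕ.+ 3)) →
  (∀ n → n ≢ t ℕ.+ 3 → n ≢ t ℕ.+ 2 → n ≢ t ∸ 1 → n ≢ t ∸ 2 → Even (coeff f n)) →
  (∀ {c} → Sign c → Even (eval c f)) →
  ∀ p → ¬ 2 ∣ p → 6 ≤ p → ¬ (Φ-p p ∣ₚ f) × ¬ (Φ-2p p ∣ₚ f)
cyclotomic∤ f t f-odd f-even f-even-at-sign p ¬2∣p 6≤p =
    subst (λ Φ → ¬ (Φ ∣ₚ f)) (sym (Φ-p≡geometric p))
      (geometric∤ {f = f} (inj₁ refl) ¬2∣p f-odd far-even (f-even-at-sign (inj₁ refl)))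
  , subst (λ Φ → ¬ (Φ ∣ₚ f)) (sym (Φ-2p≡geometric p))
      (geometric∤ {f = f} (inj₂ refl) ¬2∣p f-odd far-even (f-even-at-sign (inj₂ refl)))
  where
  far-even : ∀ n → t ℕ.+ 3 < n ⊎ n ℕ.+ p ≤ t ℕ.+ 3 → Even (coeff f n)
  far-even n far = f-even n
    (window-far 6≤p far (ℕ.≤-trans (ℕ.m∸n≤m t 2) (ℕ.m≤m+n t 3)) ℕ.≤-refl)
    (window-far 6≤p far (ℕ.≤-trans (ℕ.m∸n≤m t 2) (ℕ.m≤m+n t 2)) (ℕ.+-monoʳ-≤ t (ℕ.n≤1+n 2)))
    (window-far 6≤p far (ℕ.∸-monoʳ-≤ t (ℕ.n≤1+n 1)) (ℕ.≤-trans (ℕ.m∸n≤m t 1) (ℕ.m≤m+n t 3)))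
    (window-far 6≤p far ℕ.≤-refl (ℕ.≤-trans (ℕ.m∸n≤m t 2) (ℕ.m≤m+n t 3)))

lemma4p5 : ((t : ℕ) → 2 ∣ t → 6 ≤ t → (p : ℕ) → Prime p → 11 ≤ p →
              ¬ (Φ-p p ∣ₚ Qpoly t) × ¬ (Φ-2p p ∣ₚ Qpoly t))
         × ((t : ℕ) → 2 ∣ t → 6 ≤ t → (p : ℕ) → Prime p → 13 ≤ p →
              ¬ (Φ-p p ∣ₚ Rpoly t) × ¬ (Φ-2p p ∣ₚ Rpoly t))
lemma4p5 =
    (λ t _ _ p p-prime 11≤p →
       cyclotomic∤ (Qpoly t) t (Qpoly-odd-coeff t) (Qpoly-even-coeff t) (Qpoly-even-eval t)
                   p (prime⇒¬2∣ p-prime (11≤⇒2< 11≤p)) (11≤⇒6≤ 11≤p))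
  , (λ t _ _ p p-prime 13≤p →
       cyclotomic∤ (Rpoly t) t (Rpoly-odd-coeff t) (Rpoly-even-coeff t) (Rpoly-even-eval t)
                   p (prime⇒¬2∣ p-prime (11≤⇒2< (13≤⇒11≤ 13≤p))) (11≤⇒6≤ (13≤⇒11≤ 13≤p)))
  where
  11≤⇒2< : ∀ {p} → 11 ≤ p → 2 < p
  11≤⇒2< = ℕ.≤-trans (ℕ.m≤m+n 3 8)
  11≤⇒6≤ : ∀ {p} → 11 ≤ p → 6 ≤ p
  11≤⇒6≤ = ℕ.≤-trans (ℕ.m≤m+n 6 5)
  13≤⇒11≤ : ∀ {p} → 13 ≤ p → 11 ≤ p
  13≤⇒11≤ = ℕ.≤-trans (ℕ.m≤m+n 11 2)
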